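{- For all integers $n\ge0$ and $m$, there is a bijection between the set of Motzkin paths (respectively Grand Motzkin paths) from $(0,0)$ to $(2n,m)$ that avoid flat steps at even indices, and the set of vertically constrained $S_{DW}$ paths from $(0,0)$ to $(n,m)$ whose first step (if any) is in $\{(1,1),(1,-1)\}$ and all of whose vertices have $y\ge0$ (respectively, with no height restriction).
   Context: A lattice path is a finite sequence of steps (vectors in $\mathbb{Z}^2$) starting at $(0,0)$; its vertices are the partial sums. A Grand Motzkin path is a lattice path with steps in $\{(1,0),(1,1),(1,-1)\}$; a Motzkin path is a Grand Motzkin path all of whose vertices have $y\ge0$. The step $(1,0)$ is called flat. The steps of a path of $L$ steps are indexed $e_0,e_1,\dots,e_{L-1}$, and "avoids flat steps at even indices" means $e_i\neq(1,0)$ for every even $i$. Let $S_{DW}=\{(1,1),(1,-1),(0,1),(0,-1)\}$; $(0,\pm1)$ are vertical steps. A vertically constrained $S_{DW}$ path is a lattice path with steps in $S_{DW}$ with no two consecutive vertical steps. -}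

module Defs where

open import Level using (0ℓ)
open import Data.Nat using (ℕ; suc; _*_)
open import Data.Nat.Divisibility using (_∣_)
open import Data.Integer using (ℤ; +_; -[1+_]; _≤_) renaming (_+_ to _+ℤ_)
open import Data.Product using (Σ; _×_; _,_; proj₁; proj₂)
open import Data.Sum using (_⊎_)
open import Data.Unit using (⊤)
open import Data.Fin using (Fin; toℕ)
open import Data.List using (List; []; _∷_; length; lookup; scanl; foldl)
open import Data.List.Relation.Unary.All using (All)
open import Data.List.Membership.Propositional using (_∈_)
open import Relation.Binary.PropositionalEquality using (_≡_; _≢_; refl; sym; trans; isEquivalence)
open import Relation.Binary.Bundles using (Setoid)
open import Relation.Nullary using (¬_)

Vec2 : Set
Vec2 = ℤ × ℤ

_+v_ : Vec2 → Vec2 → Vec2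
(a , b) +v (c , d) = (a +ℤ c , b +ℤ d)

origin : Vec2
origin = (+ 0 , + 0)

-- A lattice path is a finite sequence of steps, starting at (0,0).
LatticePath : Set
LatticePath = List Vec2

vertices : LatticePath → List Vec2
vertices = scanl _+v_ origin

endpoint : LatticePath → Vec2
endpoint = foldl _+v_ origin

flat up down north south : Vec2
flat  = (+ 1 , + 0)
up    = (+ 1 , + 1)
down  = (+ 1 , -[1+ 0 ])
north = (+ 0 , + 1)
south = (+ 0 , -[1+ 0 ])

S-Motzkin : List Vec2
S-Motzkin = flat ∷ up ∷ down ∷ []

S-DW : List Vec2
S-DW = up ∷ down ∷ north ∷ south ∷ []

StepsIn : List Vec2 → LatticePath → Set
StepsIn S p = All (_∈ S) p

NonNegative : LatticePath → Set
NonNegative p = All (λ v → + 0 ≤ proj₂ v) (vertices p)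

AvoidsFlatAtEven : LatticePath → Set
AvoidsFlatAtEven p = (i : Fin (length p)) → 2 ∣ toℕ i → lookup p i ≢ flat

IsVertical : Vec2 → Set
IsVertical s = s ≡ north ⊎ s ≡ south

VerticallyConstrained : LatticePath → Set
VerticallyConstrained p =
  (i j : Fin (length p)) → toℕ j ≡ suc (toℕ i) →
  ¬ (IsVertical (lookup p i) × IsVertical (lookup p j))

FirstStepDiagonal : LatticePath → Set
FirstStepDiagonal []      = ⊤
FirstStepDiagonal (s ∷ _) = s ≡ up ⊎ s ≡ down

-- A "set of paths" given by a predicate: paths are identified when equal as
-- step sequences (the proof components are irrelevant).
PathSet : (LatticePath → Set) → Setoid 0ℓ 0ℓ
PathSet P = record
  { Carrier = Σ LatticePath P
  ; _≈_ = λ x y → proj₁ x ≡ proj₁ y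
  ; isEquivalence = record { refl = refl ; sym = sym ; trans = trans }
  }

GrandMotzkinAFE : ℕ → ℤ → LatticePath → Set
GrandMotzkinAFE n m p =
  StepsIn S-Motzkin p × endpoint p ≡ (+ (2 * n) , m) × AvoidsFlatAtEven p

MotzkinAFE : ℕ → ℤ → LatticePath → Set
MotzkinAFE n m p = GrandMotzkinAFE n m p × NonNegative p

DWPathFD : ℕ → ℤ → LatticePath → Set
DWPathFD n m p =
  StepsIn S-DW p × VerticallyConstrained p × endpoint p ≡ (+ n , m)
  × FirstStepDiagonal p

DWPathFD+ : ℕ → ℤ → LatticePath → Set
DWPathFD+ n m p = DWPathFD n m p × NonNegative p

-- An even-flat-avoiding Motzkin path of length 2n is a sequence of n blocks "diagonal step,
-- then any Motzkin step". Replacing the second step of every block by its vertical component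
-- (and deleting it when it is flat) turns the blocks into "diagonal step" and "diagonal step,
-- then vertical step", which is exactly how a vertically constrained S_DW path with diagonal
-- first step decomposes. Each block then advances by 1 instead of 2 horizontally while the
-- heights of the vertices are kept (a flat step only repeats a height), so the endpoint
-- (2n, m) becomes (n, m) and nonnegativity is preserved in both directions.
module Submission where

open import Defs
open import Data.Nat using (ℕ; zero; suc; _*_)
open import Data.Nat.Properties using (suc-injective; *-suc)
open import Data.Nat.Divisibility using (_∣0; ∣-refl; ∣1⇒≡1; ∣m∣n⇒∣m+n; ∣m+n∣m⇒∣n)
open import Data.Integer using (ℤ; +_; -[1+_]; _≤_) renaming (_+_ to _+ℤ_)
import Data.Integer.Properties as ℤ
open import Data.Product using (∃-syntax; _×_; _,_; proj₁; proj₂)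
open import Data.Sum using (_⊎_; inj₁; inj₂)
open import Data.Unit using (tt)
open import Data.Empty using (⊥-elim)
open import Data.Fin using (zero; suc)
open import Data.List using (List; []; _∷_; _++_; length; foldl; scanl)
open import Data.List.Relation.Unary.All as All using (All; []; _∷_)
open import Data.List.Relation.Unary.Any using (here; there)
open import Data.List.Membership.Propositional using (_∈_)
open import Function using (_∘_; _⇔_; mk⇔; Equivalence)
open import Function.Construct.Identity using (⇔-id)
open import Function.Construct.Composition using (_⇔-∘_)
open import Function.Bundles using (Bijection)
open import Function.Properties.Inverse using (Inverse⇒Bijection)
open import Relation.Binary.PropositionalEquality
  using (_≡_; _≢_; refl; sym; trans; cong; cong₂; subst; module ≡-Reasoning)
open import Relation.Nullary using (¬_)

open Equivalence using (to; from)
open ≡-Reasoning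

private variable
  k : ℕ
  a b s t : Vec2
  p q r xs ys : LatticePath

pathSetBijection : {P Q : LatticePath → Set} (f g : LatticePath → LatticePath) →
  (∀ {p} → P p → Q (f p)) → (∀ {q} → Q q → P (g q)) →
  (∀ {p} → P p → g (f p) ≡ p) → (∀ {q} → Q q → f (g q) ≡ q) →
  Bijection (PathSet P) (PathSet Q)
pathSetBijection f g f-closed g-closed g∘f f∘g = Inverse⇒Bijection record
  { to        = λ (p , Pp) → f p , f-closed Pp
  ; from      = λ (q , Qq) → g q , g-closed Qq
  ; to-cong   = cong f
  ; from-cong = cong g
  ; inverse   = (λ { {_ , Qq} p≡gq → trans (cong f p≡gq) (f∘g Qq) })
              , (λ { {_ , Pp} q≡fp → trans (cong g q≡fp) (g∘f Pp) })
  }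

+v-identityˡ : ∀ s → origin +v s ≡ s
+v-identityˡ (x , y) = cong₂ _,_ (ℤ.+-identityˡ x) (ℤ.+-identityˡ y)

+v-identityʳ : ∀ s → s +v origin ≡ s
+v-identityʳ (x , y) = cong₂ _,_ (ℤ.+-identityʳ x) (ℤ.+-identityʳ y)

+v-assoc : ∀ s t u → (s +v t) +v u ≡ s +v (t +v u)
+v-assoc (x , y) (x′ , y′) (x″ , y″) = cong₂ _,_ (ℤ.+-assoc x x′ x″) (ℤ.+-assoc y y′ y″)

foldl-+v : ∀ s p → foldl _+v_ s p ≡ s +v endpoint p
foldl-+v s [] = sym (+v-identityʳ s)
foldl-+v s (a ∷ p) = begin
  foldl _+v_ (s +v a) p               ≡⟨ foldl-+v (s +v a) p ⟩
  (s +v a) +v endpoint p              ≡⟨ +v-assoc s a (endpoint p) ⟩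
  s +v (a +v endpoint p)              ≡⟨ cong (λ u → s +v (u +v endpoint p)) (+v-identityˡ a) ⟨
  s +v ((origin +v a) +v endpoint p)  ≡⟨ cong (s +v_) (foldl-+v (origin +v a) p) ⟨
  s +v endpoint (a ∷ p)               ∎

endpoint-∷ : ∀ a p → endpoint (a ∷ p) ≡ a +v endpoint p
endpoint-∷ a p = trans (foldl-+v (origin +v a) p) (cong (_+v endpoint p) (+v-identityˡ a))

endpoint-x : All (λ s → proj₁ s ≡ + 1) p → proj₁ (endpoint p) ≡ + length p
endpoint-x [] = refl
endpoint-x {a ∷ p} (a₁≡1 ∷ p₁≡1) = trans (cong proj₁ (endpoint-∷ a p)) (cong₂ _+ℤ_ a₁≡1 (endpoint-x p₁≡1))

height-∷ : ∀ a p → proj₂ (endpoint (a ∷ p)) ≡ proj₂ a +ℤ proj₂ (endpoint p)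
height-∷ a p = cong proj₂ (endpoint-∷ a p)

height-++ : ∀ p q → proj₂ (endpoint (p ++ q)) ≡ proj₂ (endpoint p) +ℤ proj₂ (endpoint q)
height-++ [] q = sym (ℤ.+-identityˡ _)
height-++ (a ∷ p) q = begin
  proj₂ (endpoint (a ∷ p ++ q))                           ≡⟨ height-∷ a (p ++ q) ⟩
  proj₂ a +ℤ proj₂ (endpoint (p ++ q))                    ≡⟨ cong (proj₂ a +ℤ_) (height-++ p q) ⟩
  proj₂ a +ℤ (proj₂ (endpoint p) +ℤ proj₂ (endpoint q))   ≡⟨ ℤ.+-assoc (proj₂ a) _ _ ⟨
  (proj₂ a +ℤ proj₂ (endpoint p)) +ℤ proj₂ (endpoint q)   ≡⟨ cong (_+ℤ proj₂ (endpoint q)) (height-∷ a p) ⟨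
  proj₂ (endpoint (a ∷ p)) +ℤ proj₂ (endpoint q)          ∎

data Diagonal : Vec2 → Set where
  isUp   : Diagonal up
  isDown : Diagonal down

data MotzkinStep : Vec2 → Set where
  isFlat     : MotzkinStep flat
  isDiagonal : Diagonal a → MotzkinStep a

∈S-Motzkin⇒motzkinStep : a ∈ S-Motzkin → MotzkinStep a
∈S-Motzkin⇒motzkinStep (here refl)                 = isFlat
∈S-Motzkin⇒motzkinStep (there (here refl))         = isDiagonal isUp
∈S-Motzkin⇒motzkinStep (there (there (here refl))) = isDiagonal isDown

motzkinStep⇒∈S-Motzkin : MotzkinStep a → a ∈ S-Motzkin
motzkinStep⇒∈S-Motzkin isFlat              = here refl
motzkinStep⇒∈S-Motzkin (isDiagonal isUp)   = there (here refl)
motzkinStep⇒∈S-Motzkin (isDiagonal isDown) = there (there (here refl))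

motzkinStep-x : MotzkinStep a → proj₁ a ≡ + 1
motzkinStep-x isFlat              = refl
motzkinStep-x (isDiagonal isUp)   = refl
motzkinStep-x (isDiagonal isDown) = refl

diagonal≢flat : Diagonal a → a ≢ flat
diagonal≢flat isUp   ()
diagonal≢flat isDown ()

∈S-DW⇒diagonal⊎vertical : a ∈ S-DW → Diagonal a ⊎ IsVertical a
∈S-DW⇒diagonal⊎vertical (here refl)                         = inj₁ isUp
∈S-DW⇒diagonal⊎vertical (there (here refl))                 = inj₁ isDown
∈S-DW⇒diagonal⊎vertical (there (there (here refl)))         = inj₂ (inj₁ refl)
∈S-DW⇒diagonal⊎vertical (there (there (there (here refl)))) = inj₂ (inj₂ refl)

diagonal∈S-DW : Diagonal a → a ∈ S-DW
diagonal∈S-DW isUp   = here refl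
diagonal∈S-DW isDown = there (here refl)

vertical∈S-DW : IsVertical a → a ∈ S-DW
vertical∈S-DW (inj₁ refl) = there (there (here refl))
vertical∈S-DW (inj₂ refl) = there (there (there (here refl)))

diagonal⇒¬vertical : Diagonal a → ¬ IsVertical a
diagonal⇒¬vertical isUp   (inj₁ ())
diagonal⇒¬vertical isUp   (inj₂ ())
diagonal⇒¬vertical isDown (inj₁ ())
diagonal⇒¬vertical isDown (inj₂ ())

∈S-Motzkin⇒diagonal : a ∈ S-Motzkin → a ≢ flat → Diagonal a
∈S-Motzkin⇒diagonal a∈ a≢flat with ∈S-Motzkin⇒motzkinStep a∈
... | isFlat       = ⊥-elim (a≢flat refl)
... | isDiagonal d = d

diagonal⇒up⊎down : Diagonal a → a ≡ up ⊎ a ≡ down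
diagonal⇒up⊎down isUp   = inj₁ refl
diagonal⇒up⊎down isDown = inj₂ refl

up⊎down⇒diagonal : a ≡ up ⊎ a ≡ down → Diagonal a
up⊎down⇒diagonal (inj₁ refl) = isUp
up⊎down⇒diagonal (inj₂ refl) = isDown

data MotzkinBlocks : ℕ → LatticePath → Set where
  []    : MotzkinBlocks 0 []
  block : Diagonal a → MotzkinStep b → MotzkinBlocks k r → MotzkinBlocks (suc k) (a ∷ b ∷ r)

data DWBlocks : ℕ → LatticePath → Set where
  []    : DWBlocks 0 []
  short : Diagonal a → DWBlocks k r → DWBlocks (suc k) (a ∷ r)
  long  : Diagonal a → IsVertical b → DWBlocks k r → DWBlocks (suc k) (a ∷ b ∷ r)

avoidsFlatAtEven-drop₂ : AvoidsFlatAtEven (a ∷ b ∷ r) → AvoidsFlatAtEven r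
avoidsFlatAtEven-drop₂ avoids i 2∣i = avoids (suc (suc i)) (∣m∣n⇒∣m+n ∣-refl 2∣i)

motzkinBlocks : StepsIn S-Motzkin p → AvoidsFlatAtEven p → length p ≡ 2 * k → MotzkinBlocks k p
motzkinBlocks {[]} {zero} _ _ _ = []
motzkinBlocks {a ∷ b ∷ r} {suc k} (a∈ ∷ b∈ ∷ r∈) avoids |p|≡2k+2 =
  block (∈S-Motzkin⇒diagonal a∈ (avoids zero (2 ∣0)))
        (∈S-Motzkin⇒motzkinStep b∈)
        (motzkinBlocks r∈ (avoidsFlatAtEven-drop₂ avoids)
                       (suc-injective (suc-injective (trans |p|≡2k+2 (*-suc 2 k)))))
motzkinBlocks {_ ∷ []} {suc k} _ _ |p|≡2k+2 with () ← suc-injective (trans |p|≡2k+2 (*-suc 2 k))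

motzkinBlocks-length : MotzkinBlocks k p → length p ≡ 2 * k
motzkinBlocks-length [] = refl
motzkinBlocks-length {suc k} (block _ _ bs) =
  trans (cong (λ l → suc (suc l)) (motzkinBlocks-length bs)) (sym (*-suc 2 k))

motzkinBlocks-stepsIn : MotzkinBlocks k p → StepsIn S-Motzkin p
motzkinBlocks-stepsIn [] = []
motzkinBlocks-stepsIn (block da mb bs) =
  motzkinStep⇒∈S-Motzkin (isDiagonal da) ∷ motzkinStep⇒∈S-Motzkin mb ∷ motzkinBlocks-stepsIn bs

motzkinBlocks-avoidsFlatAtEven : MotzkinBlocks k p → AvoidsFlatAtEven p
motzkinBlocks-avoidsFlatAtEven (block da _ _)  zero          _    = diagonal≢flat da
motzkinBlocks-avoidsFlatAtEven (block _ _ _)   (suc zero)    2∣1  with () ← ∣1⇒≡1 2∣1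
motzkinBlocks-avoidsFlatAtEven (block _ _ bs)  (suc (suc i)) 2∣2+i =
  motzkinBlocks-avoidsFlatAtEven bs i (∣m+n∣m⇒∣n 2∣2+i ∣-refl)

verticallyConstrained-∷ : ¬ IsVertical a ⊎ FirstStepDiagonal r →
  VerticallyConstrained r → VerticallyConstrained (a ∷ r)
verticallyConstrained-∷ _ _ zero zero ()
verticallyConstrained-∷ _ _ (suc _) zero ()
verticallyConstrained-∷ _ vc (suc i) (suc j) j≡1+i = vc i j (suc-injective j≡1+i)
verticallyConstrained-∷ {r = []} _ _ zero (suc ())
verticallyConstrained-∷ {r = _ ∷ _} (inj₁ ¬va) _ zero (suc zero) _ (va , _) = ¬va va
verticallyConstrained-∷ {r = _ ∷ _} (inj₂ db) _ zero (suc zero) _ (_ , vb) =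
  diagonal⇒¬vertical (up⊎down⇒diagonal db) vb
verticallyConstrained-∷ {r = _ ∷ _} _ _ zero (suc (suc _)) ()

verticallyConstrained-tail : VerticallyConstrained (a ∷ r) → VerticallyConstrained r
verticallyConstrained-tail vc i j j≡1+i = vc (suc i) (suc j) (cong suc j≡1+i)

dwBlocks-∷ : Diagonal a → StepsIn S-DW r → VerticallyConstrained (a ∷ r) → ∃[ k ] DWBlocks k (a ∷ r)
dwBlocks-∷ {r = []} da _ _ = 1 , short da []
dwBlocks-∷ {r = b ∷ r} da (b∈ ∷ r∈) vc with ∈S-DW⇒diagonal⊎vertical b∈
... | inj₁ db with k , bs ← dwBlocks-∷ db r∈ (verticallyConstrained-tail vc) = suc k , short da bs
dwBlocks-∷ {r = b ∷ []} da _ _ | inj₂ vb = 1 , long da vb []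
dwBlocks-∷ {r = b ∷ c ∷ r} da (_ ∷ c∈ ∷ r∈) vc | inj₂ vb with ∈S-DW⇒diagonal⊎vertical c∈
... | inj₂ vc′ = ⊥-elim (vc (suc zero) (suc (suc zero)) refl (vb , vc′))
... | inj₁ dc with k , bs ← dwBlocks-∷ dc r∈ (verticallyConstrained-tail (verticallyConstrained-tail vc)) =
  suc k , long da vb bs

dwBlocks : StepsIn S-DW q → VerticallyConstrained q → FirstStepDiagonal q → ∃[ k ] DWBlocks k q
dwBlocks {[]} _ _ _ = 0 , []
dwBlocks {_ ∷ _} (_ ∷ r∈) vc da = dwBlocks-∷ (up⊎down⇒diagonal da) r∈ vc

dwBlocks-firstStepDiagonal : DWBlocks k q → FirstStepDiagonal q
dwBlocks-firstStepDiagonal []            = tt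
dwBlocks-firstStepDiagonal (short da _)  = diagonal⇒up⊎down da
dwBlocks-firstStepDiagonal (long da _ _) = diagonal⇒up⊎down da

dwBlocks-stepsIn : DWBlocks k q → StepsIn S-DW q
dwBlocks-stepsIn []               = []
dwBlocks-stepsIn (short da bs)    = diagonal∈S-DW da ∷ dwBlocks-stepsIn bs
dwBlocks-stepsIn (long da vb bs)  = diagonal∈S-DW da ∷ vertical∈S-DW vb ∷ dwBlocks-stepsIn bs

dwBlocks-verticallyConstrained : DWBlocks k q → VerticallyConstrained q
dwBlocks-verticallyConstrained [] ()
dwBlocks-verticallyConstrained (short da bs) =
  verticallyConstrained-∷ (inj₁ (diagonal⇒¬vertical da)) (dwBlocks-verticallyConstrained bs)
dwBlocks-verticallyConstrained (long da _ bs) =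
  verticallyConstrained-∷ (inj₁ (diagonal⇒¬vertical da))
    (verticallyConstrained-∷ (inj₂ (dwBlocks-firstStepDiagonal bs)) (dwBlocks-verticallyConstrained bs))

diagonal-x : Diagonal a → proj₁ a ≡ + 1
diagonal-x isUp   = refl
diagonal-x isDown = refl

vertical-x : IsVertical a → proj₁ a ≡ + 0
vertical-x (inj₁ refl) = refl
vertical-x (inj₂ refl) = refl

dwBlocks-x : DWBlocks k q → proj₁ (endpoint q) ≡ + k
dwBlocks-x [] = refl
dwBlocks-x {q = a ∷ r} (short da bs) =
  trans (cong proj₁ (endpoint-∷ a r)) (cong₂ _+ℤ_ (diagonal-x da) (dwBlocks-x bs))
dwBlocks-x {q = a ∷ b ∷ r} (long da vb bs) = begin
  proj₁ (endpoint (a ∷ b ∷ r))                    ≡⟨ cong proj₁ (endpoint-∷ a (b ∷ r)) ⟩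
  proj₁ a +ℤ proj₁ (endpoint (b ∷ r))             ≡⟨ cong (λ u → proj₁ a +ℤ proj₁ u) (endpoint-∷ b r) ⟩
  proj₁ a +ℤ (proj₁ b +ℤ proj₁ (endpoint r))      ≡⟨ cong₂ (λ x y → x +ℤ (y +ℤ proj₁ (endpoint r))) (diagonal-x da) (vertical-x vb) ⟩
  + 1 +ℤ (+ 0 +ℤ proj₁ (endpoint r))              ≡⟨ cong (λ x → + 1 +ℤ (+ 0 +ℤ x)) (dwBlocks-x bs) ⟩
  + suc _                                         ∎

verticalPart : Vec2 → LatticePath
verticalPart (_ , + 0) = []
verticalPart (_ , y)   = (+ 0 , y) ∷ []

toDW : LatticePath → LatticePath
toDW (a ∷ b ∷ r) = a ∷ verticalPart b ++ toDW r
toDW p           = p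

toMotzkin : LatticePath → LatticePath
toMotzkin []                  = []
toMotzkin (a ∷ (+ 0 , y) ∷ r) = a ∷ (+ 1 , y) ∷ toMotzkin r
toMotzkin (a ∷ r)             = a ∷ flat ∷ toMotzkin r

toMotzkin-∷ : FirstStepDiagonal r → toMotzkin (a ∷ r) ≡ a ∷ flat ∷ toMotzkin r
toMotzkin-∷ {[]}    _           = refl
toMotzkin-∷ {_ ∷ _} (inj₁ refl) = refl
toMotzkin-∷ {_ ∷ _} (inj₂ refl) = refl

toDW-dwBlocks : MotzkinBlocks k p → DWBlocks k (toDW p)
toDW-dwBlocks []                                = []
toDW-dwBlocks (block da isFlat bs)              = short da (toDW-dwBlocks bs)
toDW-dwBlocks (block da (isDiagonal isUp) bs)   = long da (inj₁ refl) (toDW-dwBlocks bs)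
toDW-dwBlocks (block da (isDiagonal isDown) bs) = long da (inj₂ refl) (toDW-dwBlocks bs)

toMotzkin-motzkinBlocks : DWBlocks k q → MotzkinBlocks k (toMotzkin q)
toMotzkin-motzkinBlocks [] = []
toMotzkin-motzkinBlocks (short da bs) =
  subst (MotzkinBlocks _) (sym (toMotzkin-∷ (dwBlocks-firstStepDiagonal bs)))
        (block da isFlat (toMotzkin-motzkinBlocks bs))
toMotzkin-motzkinBlocks (long da (inj₁ refl) bs) = block da (isDiagonal isUp) (toMotzkin-motzkinBlocks bs)
toMotzkin-motzkinBlocks (long da (inj₂ refl) bs) = block da (isDiagonal isDown) (toMotzkin-motzkinBlocks bs)

toMotzkin-toDW : MotzkinBlocks k p → toMotzkin (toDW p) ≡ p
toMotzkin-toDW [] = refl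
toMotzkin-toDW (block {a} {r = r} _ isFlat bs) = begin
  toMotzkin (a ∷ toDW r)            ≡⟨ toMotzkin-∷ (dwBlocks-firstStepDiagonal (toDW-dwBlocks bs)) ⟩
  a ∷ flat ∷ toMotzkin (toDW r)     ≡⟨ cong (λ r′ → a ∷ flat ∷ r′) (toMotzkin-toDW bs) ⟩
  a ∷ flat ∷ r                      ∎
toMotzkin-toDW (block {a} _ (isDiagonal isUp) bs)   = cong (λ r′ → a ∷ up ∷ r′) (toMotzkin-toDW bs)
toMotzkin-toDW (block {a} _ (isDiagonal isDown) bs) = cong (λ r′ → a ∷ down ∷ r′) (toMotzkin-toDW bs)

toDW-toMotzkin : DWBlocks k q → toDW (toMotzkin q) ≡ q
toDW-toMotzkin [] = refl
toDW-toMotzkin (short {a} {r = r} _ bs) = begin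
  toDW (toMotzkin (a ∷ r))          ≡⟨ cong toDW (toMotzkin-∷ (dwBlocks-firstStepDiagonal bs)) ⟩
  a ∷ toDW (toMotzkin r)            ≡⟨ cong (a ∷_) (toDW-toMotzkin bs) ⟩
  a ∷ r                             ∎
toDW-toMotzkin (long {a} _ (inj₁ refl) bs) = cong (λ r′ → a ∷ north ∷ r′) (toDW-toMotzkin bs)
toDW-toMotzkin (long {a} _ (inj₂ refl) bs) = cong (λ r′ → a ∷ south ∷ r′) (toDW-toMotzkin bs)

height-verticalPart : ∀ b → proj₂ (endpoint (verticalPart b)) ≡ proj₂ b
height-verticalPart (_ , + 0)      = refl
height-verticalPart (_ , + suc _)  = refl
height-verticalPart (_ , -[1+ _ ]) = refl

height-toDW : ∀ p → proj₂ (endpoint (toDW p)) ≡ proj₂ (endpoint p)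
height-toDW []          = refl
height-toDW (_ ∷ [])    = refl
height-toDW (a ∷ b ∷ r) = begin
  proj₂ (endpoint (a ∷ verticalPart b ++ toDW r))                          ≡⟨ height-∷ a (verticalPart b ++ toDW r) ⟩
  proj₂ a +ℤ proj₂ (endpoint (verticalPart b ++ toDW r))                   ≡⟨ cong (proj₂ a +ℤ_) (height-++ (verticalPart b) (toDW r)) ⟩
  proj₂ a +ℤ (proj₂ (endpoint (verticalPart b)) +ℤ proj₂ (endpoint (toDW r)))
    ≡⟨ cong₂ (λ x y → proj₂ a +ℤ (x +ℤ y)) (height-verticalPart b) (height-toDW r) ⟩
  proj₂ a +ℤ (proj₂ b +ℤ proj₂ (endpoint r))                               ≡⟨ cong (proj₂ a +ℤ_) (height-∷ b r) ⟨
  proj₂ a +ℤ proj₂ (endpoint (b ∷ r))                                      ≡⟨ height-∷ a (b ∷ r) ⟨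
  proj₂ (endpoint (a ∷ b ∷ r))                                             ∎

Above : Vec2 → Set
Above v = + 0 ≤ proj₂ v

All-scanl-head : {A B : Set} {P : A → Set} {f : A → B → A} {e : A} (xs : List B) →
  All P (scanl f e xs) → P e
All-scanl-head []      = All.head
All-scanl-head (_ ∷ _) = All.head

allAbove-∷ : proj₂ s ≡ proj₂ t → All Above xs ⇔ All Above ys → All Above (s ∷ xs) ⇔ All Above (t ∷ ys)
allAbove-∷ s≈t xs⇔ys = mk⇔
  (λ { (s⁺ ∷ xs⁺) → subst (+ 0 ≤_) s≈t s⁺ ∷ to xs⇔ys xs⁺ })
  (λ { (t⁺ ∷ ys⁺) → subst (+ 0 ≤_) (sym s≈t) t⁺ ∷ from xs⇔ys ys⁺ })

allAbove-repeat : proj₂ s ≡ proj₂ t → All Above (s ∷ scanl _+v_ t r) ⇔ All Above (scanl _+v_ t r)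
allAbove-repeat {r = r} s≈t = mk⇔ All.tail (λ ts⁺ → subst (+ 0 ≤_) (sym s≈t) (All-scanl-head r ts⁺) ∷ ts⁺)

allAbove-toDW : MotzkinBlocks k p → proj₂ s ≡ proj₂ t →
  All Above (scanl _+v_ s p) ⇔ All Above (scanl _+v_ t (toDW p))
allAbove-toDW [] s≈t = allAbove-∷ s≈t (⇔-id _)
allAbove-toDW (block {a} _ isFlat bs) s≈t =
  allAbove-∷ s≈t (allAbove-toDW bs (trans (ℤ.+-identityʳ _) (cong (_+ℤ proj₂ a) s≈t))
                   ⇔-∘ allAbove-repeat (sym (ℤ.+-identityʳ _)))
allAbove-toDW (block {a} _ (isDiagonal isUp) bs) s≈t =
  allAbove-∷ s≈t (allAbove-∷ sa≈ta (allAbove-toDW bs (cong (_+ℤ + 1) sa≈ta)))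
  where sa≈ta = cong (_+ℤ proj₂ a) s≈t
allAbove-toDW (block {a} _ (isDiagonal isDown) bs) s≈t =
  allAbove-∷ s≈t (allAbove-∷ sa≈ta (allAbove-toDW bs (cong (_+ℤ -[1+ 0 ]) sa≈ta)))
  where sa≈ta = cong (_+ℤ proj₂ a) s≈t

nonNegative-toDW : MotzkinBlocks k p → NonNegative p ⇔ NonNegative (toDW p)
nonNegative-toDW bs = allAbove-toDW bs refl

module Correspondence (n : ℕ) (m : ℤ) where

  grandMotzkinAFE⇒blocks : GrandMotzkinAFE n m p → MotzkinBlocks n p
  grandMotzkinAFE⇒blocks {p} (steps , end , avoids) = motzkinBlocks steps avoids |p|≡2n
    where
    |p|≡2n : length p ≡ 2 * n
    |p|≡2n = ℤ.+-injective (trans (sym (endpoint-x (All.map (motzkinStep-x ∘ ∈S-Motzkin⇒motzkinStep) steps)))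
                                  (cong proj₁ end))

  blocks⇒grandMotzkinAFE : MotzkinBlocks n p → proj₂ (endpoint p) ≡ m → GrandMotzkinAFE n m p
  blocks⇒grandMotzkinAFE bs height≡m = steps , cong₂ _,_ x≡2n height≡m , motzkinBlocks-avoidsFlatAtEven bs
    where
    steps = motzkinBlocks-stepsIn bs
    x≡2n = trans (endpoint-x (All.map (motzkinStep-x ∘ ∈S-Motzkin⇒motzkinStep) steps))
                 (cong +_ (motzkinBlocks-length bs))

  dwPathFD⇒blocks : DWPathFD n m q → DWBlocks n q
  dwPathFD⇒blocks {q} (steps , vc , end , fd) with k , bs ← dwBlocks steps vc fd =
    subst (λ k → DWBlocks k q) (ℤ.+-injective (trans (sym (dwBlocks-x bs)) (cong proj₁ end))) bs

  blocks⇒dwPathFD : DWBlocks n q → proj₂ (endpoint q) ≡ m → DWPathFD n m q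
  blocks⇒dwPathFD bs height≡m =
    dwBlocks-stepsIn bs , dwBlocks-verticallyConstrained bs , cong₂ _,_ (dwBlocks-x bs) height≡m
    , dwBlocks-firstStepDiagonal bs

  toDW-grandMotzkinAFE : GrandMotzkinAFE n m p → DWPathFD n m (toDW p)
  toDW-grandMotzkinAFE {p} gm@(_ , end , _) =
    blocks⇒dwPathFD (toDW-dwBlocks (grandMotzkinAFE⇒blocks gm)) (trans (height-toDW p) (cong proj₂ end))

  toMotzkin-dwPathFD : DWPathFD n m q → GrandMotzkinAFE n m (toMotzkin q)
  toMotzkin-dwPathFD {q} dw@(_ , _ , end , _) = blocks⇒grandMotzkinAFE (toMotzkin-motzkinBlocks bs) height≡m
    where
    bs = dwPathFD⇒blocks dw
    height≡m : proj₂ (endpoint (toMotzkin q)) ≡ m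
    height≡m = begin
      proj₂ (endpoint (toMotzkin q))         ≡⟨ height-toDW (toMotzkin q) ⟨
      proj₂ (endpoint (toDW (toMotzkin q)))  ≡⟨ cong (proj₂ ∘ endpoint) (toDW-toMotzkin bs) ⟩
      proj₂ (endpoint q)                     ≡⟨ cong proj₂ end ⟩
      m                                      ∎

  toDW-motzkinAFE : MotzkinAFE n m p → DWPathFD+ n m (toDW p)
  toDW-motzkinAFE (gm , nonNeg) =
    toDW-grandMotzkinAFE gm , to (nonNegative-toDW (grandMotzkinAFE⇒blocks gm)) nonNeg

  toMotzkin-dwPathFD+ : DWPathFD+ n m q → MotzkinAFE n m (toMotzkin q)
  toMotzkin-dwPathFD+ (dw , nonNeg) =
    toMotzkin-dwPathFD dw
    , from (nonNegative-toDW (toMotzkin-motzkinBlocks bs)) (subst NonNegative (sym (toDW-toMotzkin bs)) nonNeg)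
    where bs = dwPathFD⇒blocks dw

theorem14 : (n : ℕ) (m : ℤ) →
    Bijection (PathSet (MotzkinAFE n m)) (PathSet (DWPathFD+ n m))
    × Bijection (PathSet (GrandMotzkinAFE n m)) (PathSet (DWPathFD n m))
theorem14 n m =
    pathSetBijection toDW toMotzkin toDW-motzkinAFE toMotzkin-dwPathFD+
      (toMotzkin-toDW ∘ grandMotzkinAFE⇒blocks ∘ proj₁) (toDW-toMotzkin ∘ dwPathFD⇒blocks ∘ proj₁)
  , pathSetBijection toDW toMotzkin toDW-grandMotzkinAFE toMotzkin-dwPathFD
      (toMotzkin-toDW ∘ grandMotzkinAFE⇒blocks) (toDW-toMotzkin ∘ dwPathFD⇒blocks)
  where open Correspondence n m
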